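{- For $n\geq 2$ let $\Delta_n=c_{n+1}-c_n$. Then \[\Delta_n=\begin{cases}\frac{n}{2}+\Delta_{n/2} & n>3,\ n \text{ even},\\ \frac{n+1}{2} & n>3,\ n\text{ odd},\\ 1 & n=2,\\ 3 & n=3.\end{cases}\]
   Context: The sequence $(c_n)_{n\geq 2}$ is defined by $c_2=1$, $c_3=2$, and $c_n=\lfloor \frac{n}{2}\rfloor\lceil \frac{n}{2}\rceil+c_{\lceil n/2\rceil}$ for $n>3$. -}

module Defs where

open import Data.Nat using (ℕ; zero; suc; _+_; _*_; _/_; _<ᵇ_)
open import Data.Bool using (if_then_else_)
open import Data.Integer using (ℤ; +_; _-_)

⌊_/2⌋ : ℕ → ℕ
⌊ n /2⌋ = n / 2

⌈_/2⌉ : ℕ → ℕ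
⌈ n /2⌉ = (n + 1) / 2

-- Auxiliary with fuel; fuel ≥ n suffices since ⌈n/2⌉ < n for n > 3.
cAux : ℕ → ℕ → ℕ
cAux zero    n = 0
cAux (suc f) 0 = 0
cAux (suc f) 1 = 0
cAux (suc f) 2 = 1
cAux (suc f) 3 = 2
cAux (suc f) n = ⌊ n /2⌋ * ⌈ n /2⌉ + cAux f ⌈ n /2⌉

-- c n for n ≥ 2 (value at n = 0,1 is an irrelevant junk value 0)
c : ℕ → ℕ
c n = cAux n n

Δ : ℕ → ℤ
Δ n = + c (suc n) - + c n

{-# OPTIONS --safe #-}
module Submission where

-- For k ≥ 2, unfolding the recurrence once gives c (2k) = k² + c k,
-- c (2k+1) = k(k+1) + c (k+1) and c (2k+2) = (k+1)² + c (k+1).  Subtracting,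
-- Δ (2k) = k + (c (k+1) - c k) = k + Δ k and Δ (2k+1) = (k+1)² - k(k+1) = k+1.

open import Defs
open import Data.Nat using (ℕ; zero; suc; _*_; _/_; _%_; _≤_; _<_; z≤n; s≤s)
  renaming (_+_ to _+ℕ_)
open import Data.Nat.Properties
  using ( ≤-refl; ≤-trans; ≤-pred; <⇒≤; m≤n⇒m≤1+n; m≤n+m; m+n∸n≡m
        ; +-comm; +-assoc; *-suc; *-identityʳ; +-monoʳ-<; *-cancelʳ-<)
open import Data.Nat.DivMod using (m*n/n≡m; m<n*o⇒m/o<n; +-distrib-/-∣ʳ; m≡m%n+[m/n]*n; m%n<n)
open import Data.Nat.Divisibility using (_∣_; divides-refl; m%n≡0⇒n∣m)
open import Data.Integer using (+_; _+_; _⊖_)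
open import Data.Integer.Properties using ([+m]-[+n]≡m⊖n; ⊖-≥; +-cancelˡ-⊖; distribʳ-⊖-+-pos)
open import Data.Product using (_×_; _,_)
open import Relation.Nullary using (¬_; contradiction)
open import Relation.Binary.PropositionalEquality
  using (_≡_; refl; sym; trans; subst; cong; cong₂; module ≡-Reasoning)
open ≡-Reasoning

⌊1+k*2/2⌋≡k : ∀ k → ⌊ suc (k * 2) /2⌋ ≡ k
⌊1+k*2/2⌋≡k k = trans (+-distrib-/-∣ʳ 1 {d = 2} (divides-refl k)) (m*n/n≡m k 2)

⌈k*2/2⌉≡k : ∀ k → ⌈ k * 2 /2⌉ ≡ k
⌈k*2/2⌉≡k k = trans (cong (_/ 2) (+-comm (k * 2) 1)) (⌊1+k*2/2⌋≡k k)

⌈1+k*2/2⌉≡1+k : ∀ k → ⌈ suc (k * 2) /2⌉ ≡ suc k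
⌈1+k*2/2⌉≡1+k k = trans (cong (_/ 2) (+-comm (suc (k * 2)) 1)) (m*n/n≡m (suc k) 2)

⌈n/2⌉<n : ∀ {n} → 1 < n → ⌈ n /2⌉ < n
⌈n/2⌉<n {n} 1<n = m<n*o⇒m/o<n (subst (n +ℕ 1 <_) n+n≡n*2 (+-monoʳ-< n 1<n))
  where
  n+n≡n*2 : n +ℕ n ≡ n * 2
  n+n≡n*2 = trans (cong (n +ℕ_) (sym (*-identityʳ n))) (sym (*-suc n 1))

odd⇒≡1+[n/2]*2 : ∀ n → ¬ 2 ∣ n → n ≡ suc (n / 2 * 2)
odd⇒≡1+[n/2]*2 n 2∤n with n % 2 in n%2≡r | m≡m%n+[m/n]*n n 2 | m%n<n n 2
... | 0           | _  | _               = contradiction (m%n≡0⇒n∣m n 2 n%2≡r) 2∤n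
... | 1           | eq | _               = eq
... | suc (suc _) | _  | s≤s (s≤s ())

cAux-fuel-irrelevant : ∀ {f g m} → m ≤ f → m ≤ g → cAux f m ≡ cAux g m
cAux-fuel-irrelevant {zero}  {zero}  z≤n z≤n = refl
cAux-fuel-irrelevant {zero}  {suc g} z≤n _   = refl
cAux-fuel-irrelevant {suc f} {zero}  _   z≤n = refl
cAux-fuel-irrelevant {suc f} {suc g} {0} _ _ = refl
cAux-fuel-irrelevant {suc f} {suc g} {1} _ _ = refl
cAux-fuel-irrelevant {suc f} {suc g} {2} _ _ = refl
cAux-fuel-irrelevant {suc f} {suc g} {3} _ _ = refl
cAux-fuel-irrelevant {suc f} {suc g} {m@(suc (suc (suc (suc _))))} m≤1+f m≤1+g =
  cong (⌊ m /2⌋ * ⌈ m /2⌉ +ℕ_)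
       (cAux-fuel-irrelevant (≤-pred (≤-trans ⌈m/2⌉<m m≤1+f)) (≤-pred (≤-trans ⌈m/2⌉<m m≤1+g)))
  where
  ⌈m/2⌉<m : ⌈ m /2⌉ < m
  ⌈m/2⌉<m = ⌈n/2⌉<n (s≤s (s≤s z≤n))

c-recurrence : ∀ {n} → 3 < n → c n ≡ ⌊ n /2⌋ * ⌈ n /2⌉ +ℕ c ⌈ n /2⌉
c-recurrence {n} (s≤s (s≤s (s≤s (s≤s _)))) =
  cong (⌊ n /2⌋ * ⌈ n /2⌉ +ℕ_) (cAux-fuel-irrelevant (≤-pred (⌈n/2⌉<n {n} (s≤s (s≤s z≤n)))) ≤-refl)

c-double : ∀ {k} → 1 < k → c (k * 2) ≡ k * k +ℕ c k
c-double {k} (s≤s (s≤s _)) = begin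
  c (k * 2)                                   ≡⟨ c-recurrence {k * 2} (s≤s (s≤s (s≤s (s≤s z≤n)))) ⟩
  ⌊ k * 2 /2⌋ * ⌈ k * 2 /2⌉ +ℕ c ⌈ k * 2 /2⌉  ≡⟨ cong₂ (λ a b → a * b +ℕ c b) (m*n/n≡m k 2) (⌈k*2/2⌉≡k k) ⟩
  k * k +ℕ c k                                ∎

c-suc-double : ∀ {k} → 1 < k → c (suc (k * 2)) ≡ k * suc k +ℕ c (suc k)
c-suc-double {k} (s≤s (s≤s _)) = begin
  c (suc (k * 2))                                               ≡⟨ c-recurrence {suc (k * 2)} (s≤s (s≤s (s≤s (s≤s z≤n)))) ⟩
  ⌊ suc (k * 2) /2⌋ * ⌈ suc (k * 2) /2⌉ +ℕ c ⌈ suc (k * 2) /2⌉  ≡⟨ cong₂ (λ a b → a * b +ℕ c b) (⌊1+k*2/2⌋≡k k) (⌈1+k*2/2⌉≡1+k k) ⟩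
  k * suc k +ℕ c (suc k)                                        ∎

m+n⊖n≡m : ∀ m n → (m +ℕ n) ⊖ n ≡ + m
m+n⊖n≡m m n = trans (⊖-≥ (m≤n+m n m)) (cong +_ (m+n∸n≡m m n))

Δ≡⊖ : ∀ n → Δ n ≡ c (suc n) ⊖ c n
Δ≡⊖ n = [+m]-[+n]≡m⊖n (c (suc n)) (c n)

Δ-double : ∀ {k} → 1 < k → Δ (k * 2) ≡ + k + Δ k
Δ-double {k} 1<k = begin
  Δ (k * 2)                                       ≡⟨ Δ≡⊖ (k * 2) ⟩
  c (suc (k * 2)) ⊖ c (k * 2)                     ≡⟨ cong₂ _⊖_ (c-suc-double 1<k) (c-double 1<k) ⟩
  (k * suc k +ℕ c (suc k)) ⊖ (k * k +ℕ c k)       ≡⟨ cong (_⊖ (k * k +ℕ c k)) (k*[1+k]+m≡k*k+[k+m] (c (suc k))) ⟩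
  (k * k +ℕ (k +ℕ c (suc k))) ⊖ (k * k +ℕ c k)    ≡⟨ +-cancelˡ-⊖ (k * k) (k +ℕ c (suc k)) (c k) ⟩
  (k +ℕ c (suc k)) ⊖ c k                          ≡⟨ distribʳ-⊖-+-pos k (c (suc k)) (c k) ⟨
  + k + (c (suc k) ⊖ c k)                         ≡⟨ cong (_+_ (+ k)) (Δ≡⊖ k) ⟨
  + k + Δ k                                       ∎
  where
  k*[1+k]+m≡k*k+[k+m] : ∀ m → k * suc k +ℕ m ≡ k * k +ℕ (k +ℕ m)
  k*[1+k]+m≡k*k+[k+m] m = begin
    k * suc k +ℕ m      ≡⟨ cong (_+ℕ m) (trans (*-suc k k) (+-comm k (k * k))) ⟩
    k * k +ℕ k +ℕ m     ≡⟨ +-assoc (k * k) k m ⟩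
    k * k +ℕ (k +ℕ m)   ∎

Δ-suc-double : ∀ {k} → 1 < k → Δ (suc (k * 2)) ≡ + suc k
Δ-suc-double {k} 1<k = begin
  Δ (suc (k * 2))                             ≡⟨ Δ≡⊖ (suc (k * 2)) ⟩
  c (suc k * 2) ⊖ c (suc (k * 2))             ≡⟨ cong₂ _⊖_ (c-double (m≤n⇒m≤1+n 1<k)) (c-suc-double 1<k) ⟩
  (suc k * suc k +ℕ c (suc k)) ⊖ c[1+k*2]     ≡⟨ cong (_⊖ c[1+k*2]) (+-assoc (suc k) (k * suc k) (c (suc k))) ⟩
  (suc k +ℕ c[1+k*2]) ⊖ c[1+k*2]              ≡⟨ m+n⊖n≡m (suc k) c[1+k*2] ⟩
  + suc k                                     ∎
  where
  c[1+k*2] : ℕ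
  c[1+k*2] = k * suc k +ℕ c (suc k)

Δ-even : (n : ℕ) → 3 < n → 2 ∣ n → Δ n ≡ + (n / 2) + Δ (n / 2)
Δ-even .(k * 2) 3<n (divides-refl k) =
  trans (Δ-double (*-cancelʳ-< 2 1 k (<⇒≤ 3<n))) (cong (λ m → + m + Δ m) (sym (m*n/n≡m k 2)))

Δ-odd : (n : ℕ) → 3 < n → ¬ (2 ∣ n) → Δ n ≡ + ((n Data.Nat.+ 1) / 2)
Δ-odd n 3<n 2∤n with n / 2 | odd⇒≡1+[n/2]*2 n 2∤n
... | k | refl = trans (Δ-suc-double (*-cancelʳ-< 2 1 k (≤-pred 3<n))) (cong +_ (sym (⌈1+k*2/2⌉≡1+k k)))

mainTheorem16 :
    ((n : ℕ) → 3 < n → 2 ∣ n → Δ n ≡ + (n / 2) + Δ (n / 2))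
      × ((n : ℕ) → 3 < n → ¬ (2 ∣ n) → Δ n ≡ + ((n Data.Nat.+ 1) / 2))
      × (Δ 2 ≡ + 1)
      × (Δ 3 ≡ + 3)
mainTheorem16 = Δ-even , Δ-odd , refl , refl
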